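{- Let $p\geq 1$ be an integer and let $G$ be a finite simple graph which is both $(P_3\cup P_2)$-free and $((K_1\cup K_2)+K_p)$-free, with $\omega(G)\geq p+2$. Let $A=\{v_1,\dots,v_\omega\}$ be a maximum clique of $G$ and let the sets $C_{i,j}$ be defined with respect to $A$ as in the context. Then: (i) for $(i,j)\in L$, if $\omega(\langle C_{i,j}\rangle)\geq p-j+4$, then $\omega(\langle C_{k,j}\rangle)\leq 1$ for every $k\neq i$ with $1\leq k\leq j-1$; (ii) if $\omega(G)=p+2+k$ with $k\geq 0$, then the subgraph of $G$ induced by $\bigcup_{j=\max\{2,\,p+1-\lfloor k/2\rfloor\}}^{p+1}\ \bigcup_{i=1}^{j-1}C_{i,j}$ is $P_3$-free.
   Context: All graphs are finite, simple, undirected. $\omega(\cdot)$ is the clique number; $\langle S\rangle$ is the subgraph induced by $S$. $P_n$ is the path on $n$ vertices, $K_n$ the complete graph; $G_1\cup G_2$ is disjoint union and $G_1+G_2$ is the join (disjoint union plus all edges between the two parts). A graph is $H$-free if it has no induced subgraph isomorphic to $H$. Partition: let $A=\{v_1,\dots,v_\omega\}$ be a maximum clique of $G$, $\omega=\omega(G)$. Let $L=\{(i,j):1\le i<j\le\omega\}$ ordered lexicographically. For $(i,j)\in L$, $C_{i,j}$ is the set of vertices $v\in V(G)\setminus A$ adjacent to neither $v_i$ nor $v_j$, minus all $C_{i',j'}$ with $(i',j')$ lexicographically before $(i,j)$. -}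

module Defs where

open import Data.Nat using (ℕ; zero; suc; _+_; _∸_; _≤_; _<ᵇ_; _≡ᵇ_)
open import Data.Fin using (Fin; toℕ; _≟_)
import Data.Fin as F
open import Data.Bool using (Bool; true; false; if_then_else_; _∧_; _∨_; not)
open import Data.Product using (Σ; _×_; ∃)
open import Data.Sum using (_⊎_)
open import Data.Empty using (⊥)
open import Relation.Nullary using (¬_; does)
open import Relation.Binary.PropositionalEquality using (_≡_; _≢_)
open import Function.Definitions using (Injective)

record Graph : Set where
  field
    n     : ℕ
    adj   : Fin n → Fin n → Bool
    sym   : ∀ a b → adj a b ≡ adj b a
    irref : ∀ a → adj a a ≡ false
open Graph public

Vertex : Graph → Set
Vertex G = Fin (n G)

mkAdj : ∀ {m} → (Fin m → Fin m → Bool) → Fin m → Fin m → Bool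
mkAdj e a b = if does (a ≟ b) then false else (e a b ∨ e b a)

private
  ≟-sym : ∀ {m} (a b : Fin m) → does (a ≟ b) ≡ does (b ≟ a)
  ≟-sym a b with a ≟ b | b ≟ a
  ... | Relation.Nullary.yes _ | Relation.Nullary.yes _ = _≡_.refl
  ... | Relation.Nullary.no _ | Relation.Nullary.no _ = _≡_.refl
  ... | Relation.Nullary.yes p | Relation.Nullary.no q = Data.Empty.⊥-elim (q (Relation.Binary.PropositionalEquality.sym p))
  ... | Relation.Nullary.no q | Relation.Nullary.yes p = Data.Empty.⊥-elim (q (Relation.Binary.PropositionalEquality.sym p))

  ∨-comm : ∀ x y → (x ∨ y) ≡ (y ∨ x)
  ∨-comm false false = _≡_.refl
  ∨-comm false true = _≡_.refl
  ∨-comm true false = _≡_.refl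
  ∨-comm true true = _≡_.refl

mkAdj-sym : ∀ {m} (e : Fin m → Fin m → Bool) a b → mkAdj e a b ≡ mkAdj e b a
mkAdj-sym e a b rewrite ≟-sym a b with does (b ≟ a)
... | true = _≡_.refl
... | false = ∨-comm (e a b) (e b a)

mkAdj-irr : ∀ {m} (e : Fin m → Fin m → Bool) a → mkAdj e a a ≡ false
mkAdj-irr e a with a ≟ a
... | Relation.Nullary.yes _ = _≡_.refl
... | Relation.Nullary.no ¬p = Data.Empty.⊥-elim (¬p _≡_.refl)

mkGraph : (m : ℕ) → (Fin m → Fin m → Bool) → Graph
mkGraph m e = record { n = m ; adj = mkAdj e ; sym = mkAdj-sym e ; irref = mkAdj-irr e }

P₃ : Graph
P₃ = mkGraph 3 (λ a b → ((toℕ a ≡ᵇ 0) ∧ (toℕ b ≡ᵇ 1)) ∨ ((toℕ a ≡ᵇ 1) ∧ (toℕ b ≡ᵇ 2)))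

P₃∪P₂ : Graph
P₃∪P₂ = mkGraph 5 (λ a b → ((toℕ a ≡ᵇ 0) ∧ (toℕ b ≡ᵇ 1))
                         ∨ ((toℕ a ≡ᵇ 1) ∧ (toℕ b ≡ᵇ 2))
                         ∨ ((toℕ a ≡ᵇ 3) ∧ (toℕ b ≡ᵇ 4)))

-- (K₁ ∪ K₂) + K_p : vertex 0 is the K₁, vertices 1,2 form the K₂,
-- vertices 3..p+2 form the K_p, joined to everything.
-- Edges: 12, and every pair containing a vertex ≥ 3.
[K₁∪K₂]+K : ℕ → Graph
[K₁∪K₂]+K p = mkGraph (p + 3) (λ a b → ((toℕ a ≡ᵇ 1) ∧ (toℕ b ≡ᵇ 2))
                                     ∨ not (toℕ a <ᵇ 3) ∨ not (toℕ b <ᵇ 3))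

InducedCopyIn : (G : Graph) → (Vertex G → Set) → Graph → Set
InducedCopyIn G S H =
  Σ (Vertex H → Vertex G) λ f →
    Injective _≡_ _≡_ f × (∀ a → S (f a)) × (∀ a b → adj G (f a) (f b) ≡ adj H a b)

InducedFreeOn : (G : Graph) → (Vertex G → Set) → Graph → Set
InducedFreeOn G S H = ¬ InducedCopyIn G S H

Free : Graph → Graph → Set
Free G H = InducedFreeOn G (λ _ → Data.Unit.⊤) H
  where import Data.Unit

-- A clique of size k in ⟨S⟩ (so ω(⟨S⟩) ≥ k iff CliqueIn G S k).
CliqueIn : (G : Graph) → (Vertex G → Set) → ℕ → Set
CliqueIn G S k =
  Σ (Fin k → Vertex G) λ f →
    Injective _≡_ _≡_ f × (∀ a → S (f a)) × (∀ a b → a ≢ b → adj G (f a) (f b) ≡ true)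

IsClique : (G : Graph) → {k : ℕ} → (Fin k → Vertex G) → Set
IsClique G v = Injective _≡_ _≡_ v × (∀ a b → a ≢ b → adj G (v a) (v b) ≡ true)

IsMaxClique : (G : Graph) → {k : ℕ} → (Fin k → Vertex G) → Set
IsMaxClique G {k} v = IsClique G v × (∀ m → CliqueIn G (λ _ → Data.Unit.⊤) m → m ≤ k)
  where import Data.Unit

LexLt : ∀ {w} → Fin w → Fin w → Fin w → Fin w → Set
LexLt i' j' i j = (i' F.< i) ⊎ ((i' ≡ i) × (j' F.< j))

-- C_{i,j} with respect to the clique A = {v_0,…,v_{ω-1}} (0-based Fin
-- indices: Fin index i corresponds to the paper's index toℕ i + 1).
C : (G : Graph) → {w : ℕ} → (Fin w → Vertex G) → Fin w → Fin w → Vertex G → Set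
C G {w} v i j x =
  (∀ a → x ≢ v a)
  × adj G x (v i) ≡ false
  × adj G x (v j) ≡ false
  × (∀ i' j' → i' F.< j' → LexLt i' j' i j → (adj G x (v i') ≡ true ⊎ adj G x (v j') ≡ true))

-- Every x ∈ C_{i,j} misses v_i and v_j but, by the choice of (i, j) as the first pair it misses,
-- sees every v_t with t < j, t ≠ i. As A is a clique, ((K₁ ∪ K₂) + K_p)-freeness then leaves x
-- fewer than p neighbours in A.
--
-- (i) For j > p + 1 this already makes C_{k,j} empty. Otherwise let Q be a clique of size
-- p - j + 4 in C_{i,j} and H = {v_t : t < j, t ∉ {i, k}}: H ∪ Q is a clique seeing v_k, and H
-- sees all of C_{i,j} ∪ C_{k,j}. A vertex u of C_{k,j} missing two vertices of Q gives a P₃ ∪ P₂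
-- (the path u v_i v_j and that edge of Q); missing exactly one, q, it gives a (K₁ ∪ K₂) + K_p
-- (u, the edge q v_k and H ∪ Q - q). So C_{k,j} is complete to Q, and an edge yz of C_{k,j}
-- with v_k and H ∪ Q, of size p + 1, is a (K₁ ∪ K₂) + K_p.
--
-- (ii) A vertex of C_{i,j} with j > L sees at least L - 1 of v_1, …, v_L, hence at most p - L of
-- the ω - L later vertices of A. For a path xyz in the union, taking L = p - ⌊k/2⌋ gives
-- ω - L - 3(p - L) ≥ 2, so two vertices of A miss x, y and z and form a P₃ ∪ P₂ with the path.

module Submission where

open import Defs
open import Data.Nat
  using (ℕ; zero; suc; _+_; _*_; _∸_; _≤_; _/_; _⊔_; z≤n; s≤s; s≤s⁻¹; s<s; s<s⁻¹; _≡ᵇ_; _<ᵇ_)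
  renaming (_<_ to _<ℕ_; _<?_ to _<ℕ?_)
open import Data.Nat.Properties
  using (≤-refl; ≤-trans; ≤-reflexive; ≤-antisym; <⇒≤; <-≤-trans; <⇒≱; ≰⇒>; ≮⇒≥; m≤n⇒m≤1+n; 0≢1+n;
         +-suc; +-comm; +-assoc; +-monoˡ-≤; +-monoʳ-≤; +-mono-≤; +-cancelˡ-≤; +-cancelʳ-≤;
         m≤n+m∸n; m≤n+o⇒m∸n≤o; m+[n∸m]≡n; m≤n⊔m; module ≤-Reasoning)
open import Data.Nat.DivMod using (m/n*n≤m)
open import Data.Nat.Tactic.RingSolver using (solve-∀)
open import Data.Fin using (Fin; zero; suc; toℕ; cast; splitAt; join; inject≤; _≟_; _<_)
open import Data.Fin.Patterns using (0F; 1F; 2F; 3F; 4F)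
import Data.Fin.Properties as Fin
open import Data.Vec.Functional using ([]; _∷_; _++_)
open import Data.Bool using (Bool; true; false; if_then_else_; _∨_; _∧_; not)
import Data.Bool.Properties as Bool
open import Data.Product using (Σ; _×_; _,_; proj₁; proj₂)
open import Data.Sum using (_⊎_; inj₁; inj₂; [_,_]′)
open import Data.Unit using (⊤; tt)
open import Function using (id; _∘_)
open import Function.Definitions using (Injective)
open import Level using (Level)
open import Relation.Binary using (tri<; tri≈; tri>)
open import Relation.Nullary using (¬_; Dec; does; yes; no; contradiction; ¬?)
open import Relation.Nullary.Decidable using (_×-dec_; decidable-stable)
open import Relation.Unary using (Pred; Decidable; _⊆_; _∪_; _∩_; ∁)
open import Relation.Unary.Properties using (_∪?_; _∩?_; ∁?)
open import Relation.Binary.PropositionalEquality as ≡ using (_≡_; _≢_; refl; cong; cong₂; trans)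

private variable
  ℓ ℓ′ : Level
  N : ℕ

injective-∷ : ∀ {A : Set} {m} {a : A} {f : Fin m → A}
            → (∀ t → a ≢ f t) → Injective _≡_ _≡_ f → Injective _≡_ _≡_ (a ∷ f)
injective-∷ fresh f-inj {zero}  {zero}  _ = refl
injective-∷ fresh f-inj {zero}  {suc t} e = contradiction e (fresh t)
injective-∷ fresh f-inj {suc s} {zero}  e = contradiction (≡.sym e) (fresh s)
injective-∷ fresh f-inj {suc s} {suc t} e = cong suc (f-inj e)

injective-[] : ∀ {A : Set} → Injective _≡_ _≡_ ([] {A = A})
injective-[] {x = ()}

injective-++ : ∀ {A : Set} {m n} {f : Fin m → A} {g : Fin n → A}
             → Injective _≡_ _≡_ f → Injective _≡_ _≡_ g → (∀ s t → f s ≢ g t)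
             → Injective _≡_ _≡_ (f ++ g)
injective-++ {m = m} {n} {f} {g} f-inj g-inj f≢g {s} {t} e =
  trans (≡.sym (Fin.join-splitAt m n s))
        (trans (cong (join m n) (inj {splitAt m s} {splitAt m t} e)) (Fin.join-splitAt m n t))
  where
  inj : ∀ {u v} → [ f , g ]′ u ≡ [ f , g ]′ v → u ≡ v
  inj {inj₁ a} {inj₁ b} e = cong inj₁ (f-inj e)
  inj {inj₁ a} {inj₂ b} e = contradiction e (f≢g a b)
  inj {inj₂ a} {inj₁ b} e = contradiction (≡.sym e) (f≢g b a)
  inj {inj₂ a} {inj₂ b} e = cong inj₂ (g-inj e)

cast-injective : ∀ {m n} .(eq : m ≡ n) → Injective _≡_ _≡_ (cast eq)
cast-injective eq {s} {t} e =
  Fin.toℕ-injective (trans (≡.sym (Fin.toℕ-cast eq s)) (trans (cong toℕ e) (Fin.toℕ-cast eq t)))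

-- Counting

count : {P : Pred (Fin N) ℓ} → Decidable P → ℕ
count {N = zero}  P? = 0
count {N = suc N} P? = (if does (P? zero) then suc else id) (count (P? ∘ suc))

count-mono : {P : Pred (Fin N) ℓ} {Q : Pred (Fin N) ℓ′} (P? : Decidable P) (Q? : Decidable Q)
           → P ⊆ Q → count P? ≤ count Q?
count-mono {N = zero}  P? Q? P⊆Q = z≤n
count-mono {N = suc N} P? Q? P⊆Q with P? zero | Q? zero
... | yes _ | yes _ = s≤s (count-mono (P? ∘ suc) (Q? ∘ suc) P⊆Q)
... | no _  | yes _ = m≤n⇒m≤1+n (count-mono (P? ∘ suc) (Q? ∘ suc) P⊆Q)
... | no _  | no _  = count-mono (P? ∘ suc) (Q? ∘ suc) P⊆Q
... | yes p | no ¬q = contradiction (P⊆Q p) ¬q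

count-cong : {P : Pred (Fin N) ℓ} {Q : Pred (Fin N) ℓ′} (P? : Decidable P) (Q? : Decidable Q)
           → P ⊆ Q → Q ⊆ P → count P? ≡ count Q?
count-cong P? Q? P⊆Q Q⊆P = ≤-antisym (count-mono P? Q? P⊆Q) (count-mono Q? P? Q⊆P)

count-split : {P : Pred (Fin N) ℓ} {Q : Pred (Fin N) ℓ′} (P? : Decidable P) (Q? : Decidable Q)
            → count P? ≡ count (P? ∩? Q?) + count (P? ∩? ∁? Q?)
count-split {N = zero}  P? Q? = refl
count-split {N = suc N} P? Q? with P? zero | Q? zero | count-split (P? ∘ suc) (Q? ∘ suc)
... | yes _ | yes _ | ih = cong suc ih
... | yes _ | no _  | ih = trans (cong suc ih) (≡.sym (+-suc _ _))
... | no _  | _     | ih = ih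

count-∁ : {P : Pred (Fin N) ℓ} (P? : Decidable P) → count P? + count (∁? P?) ≡ N
count-∁ {N = zero}  P? = refl
count-∁ {N = suc N} P? with P? zero
... | yes _ = cong suc (count-∁ (P? ∘ suc))
... | no _  = trans (+-suc _ _) (cong suc (count-∁ (P? ∘ suc)))

count-∪ : {P : Pred (Fin N) ℓ} {Q : Pred (Fin N) ℓ′} (P? : Decidable P) (Q? : Decidable Q)
        → count (P? ∪? Q?) ≤ count P? + count Q?
count-∪ {N = zero}  P? Q? = z≤n
count-∪ {N = suc N} P? Q? with P? zero | Q? zero | count-∪ (P? ∘ suc) (Q? ∘ suc)
... | yes _ | yes _ | ih = s≤s (≤-trans ih (≤-trans (m≤n⇒m≤1+n ≤-refl) (≤-reflexive (≡.sym (+-suc _ _)))))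
... | yes _ | no _  | ih = s≤s ih
... | no _  | yes _ | ih = ≤-trans (s≤s ih) (≤-reflexive (≡.sym (+-suc _ _)))
... | no _  | no _  | ih = ih

count-∅ : {P : Pred (Fin N) ℓ} (P? : Decidable P) → (∀ t → ¬ P t) → count P? ≡ 0
count-∅ {N = zero}  P? ¬P = refl
count-∅ {N = suc N} P? ¬P with P? zero
... | yes p = contradiction p (¬P zero)
... | no _  = count-∅ (P? ∘ suc) (¬P ∘ suc)

count-≤1 : {P : Pred (Fin N) ℓ} (P? : Decidable P) → (∀ {s t} → P s → P t → s ≡ t) → count P? ≤ 1
count-≤1 {N = zero}  P? unique = z≤n
count-≤1 {N = suc N} P? unique with P? zero
... | yes p = s≤s (≤-reflexive (count-∅ (P? ∘ suc) λ _ q → 0≢1+n (cong toℕ (unique p q))))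
... | no _  = count-≤1 (P? ∘ suc) λ p q → Fin.suc-injective (unique p q)

count-< : ∀ L → L ≤ N → count (λ (t : Fin N) → toℕ t <ℕ? L) ≡ L
count-< {N = N} zero _ = count-∅ (λ (t : Fin N) → toℕ t <ℕ? 0) λ _ ()
count-< {N = suc N} (suc L) (s≤s L≤N) =
  cong suc (trans (count-cong (λ (t : Fin N) → suc (toℕ t) <ℕ? suc L) (λ t → toℕ t <ℕ? L) s<s⁻¹ s<s)
                  (count-< L L≤N))

count-remove : {P : Pred (Fin N) ℓ} (P? : Decidable P) (k : Fin N)
             → count P? ≤ suc (count (P? ∩? ∁? (_≟ k)))
count-remove P? k = begin
  count P?                                         ≡⟨ count-split P? (_≟ k) ⟩
  count (P? ∩? (_≟ k)) + count (P? ∩? ∁? (_≟ k))  ≤⟨ +-monoˡ-≤ _ at-most-k ⟩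
  suc (count (P? ∩? ∁? (_≟ k)))                    ∎
  where
  open ≤-Reasoning
  at-most-k : count (P? ∩? (_≟ k)) ≤ 1
  at-most-k = count-≤1 (P? ∩? (_≟ k)) λ { (_ , refl) (_ , refl) → refl }

pick : {P : Pred (Fin N) ℓ} (P? : Decidable P) {m : ℕ} → m ≤ count P?
     → Σ (Fin m → Fin N) λ f → Injective _≡_ _≡_ f × (∀ a → P (f a))
pick P? {zero} _ = [] , injective-[] , λ ()
pick {N = suc N} P? {suc m} m≤ with P? zero
... | yes p with pick (P? ∘ suc) (s≤s⁻¹ m≤)
...   | f , f-inj , f-P =
  zero ∷ suc ∘ f , injective-∷ (λ _ ()) (f-inj ∘ Fin.suc-injective) , λ { zero → p ; (suc a) → f-P a }
pick {N = suc N} P? {suc m} m≤ | no _ with pick (P? ∘ suc) m≤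
... | f , f-inj , f-P = suc ∘ f , f-inj ∘ Fin.suc-injective , f-P

-- Cliques and induced copies

K-rule : ℕ → ℕ → Bool
K-rule m n = ((m ≡ᵇ 1) ∧ (n ≡ᵇ 2)) ∨ not (m <ᵇ 3) ∨ not (n <ᵇ 3)

mkAdj-cast : ∀ {m n} (eq : m ≡ n) (E : ℕ → ℕ → Bool) (s t : Fin m)
           → mkAdj (λ a b → E (toℕ a) (toℕ b)) s t
           ≡ mkAdj (λ a b → E (toℕ a) (toℕ b)) (cast eq s) (cast eq t)
mkAdj-cast eq E s t =
  cong₂ (λ d e → if d then false else e) does-cast
        (cong₂ _∨_ (cong₂ E (≡.sym (Fin.toℕ-cast eq s)) (≡.sym (Fin.toℕ-cast eq t)))
                   (cong₂ E (≡.sym (Fin.toℕ-cast eq t)) (≡.sym (Fin.toℕ-cast eq s))))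
  where
  does-cast : does (s ≟ t) ≡ does (cast eq s ≟ cast eq t)
  does-cast with s ≟ t | cast eq s ≟ cast eq t
  ... | yes _    | yes _  = refl
  ... | no _     | no _   = refl
  ... | yes refl | no ne  = contradiction refl ne
  ... | no ne    | yes e  = contradiction (cast-injective eq e) ne

module Adjacency (G : Graph) where

  infix 4 _~_ _≁_ _~?_ _≁?_

  _~_ _≁_ : Vertex G → Vertex G → Set
  x ~ y = adj G x y ≡ true
  x ≁ y = adj G x y ≡ false

  _~?_ : ∀ x y → Dec (x ~ y)
  x ~? y = adj G x y Bool.≟ true

  _≁?_ : ∀ x y → Dec (x ≁ y)
  x ≁? y = adj G x y Bool.≟ false

  variable
    a b c x y z : Vertex G
    m : ℕ

  ~-sym : x ~ y → y ~ x
  ~-sym {x} {y} = trans (Graph.sym G y x)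

  ≁-sym : x ≁ y → y ≁ x
  ≁-sym {x} {y} = trans (Graph.sym G y x)

  ¬~⇒≁ : ¬ x ~ y → x ≁ y
  ¬~⇒≁ = Bool.¬-not

  ~⇒≢ : x ~ y → x ≢ y
  ~⇒≢ {x} x~y refl = contradiction (trans (≡.sym (irref G x)) x~y) λ ()

  ~-≁⇒≢ : x ~ z → y ≁ z → x ≢ y
  ~-≁⇒≢ x~z y≁z refl = contradiction (trans (≡.sym y≁z) x~z) λ ()

  ≁-~⇒≢ : x ≁ z → y ~ z → x ≢ y
  ≁-~⇒≢ x≁z y~z = ~-≁⇒≢ y~z x≁z ∘ ≡.sym

  CommonNbr CommonNonNbr : Vertex G → Vertex G → Vertex G → Pred (Vertex G) _
  CommonNbr    a b c x = a ~ x × b ~ x × c ~ x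
  CommonNonNbr a b c x = a ≁ x × b ≁ x × c ≁ x

  CliqueIn-mono : ∀ {S T : Pred (Vertex G) _} → S ⊆ T → CliqueIn G S m → CliqueIn G T m
  CliqueIn-mono S⊆T (f , f-inj , f-S , f-cl) = f , f-inj , S⊆T ∘ f-S , f-cl

  CliqueIn-shrink : ∀ {S k} → k ≤ m → CliqueIn G S m → CliqueIn G S k
  CliqueIn-shrink k≤m (f , f-inj , f-S , f-cl) =
    f ∘ ι , ι-inj ∘ f-inj , f-S ∘ ι , λ s t s≢t → f-cl (ι s) (ι t) (s≢t ∘ ι-inj)
    where
    ι = λ t → inject≤ t k≤m
    ι-inj : Injective _≡_ _≡_ ι
    ι-inj = Fin.inject≤-injective k≤m k≤m _ _

  CliqueIn-++ : ∀ {S T : Pred (Vertex G) _} {m₁ m₂} → (∀ {x y} → S x → T y → x ~ y)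
              → CliqueIn G S m₁ → CliqueIn G T m₂ → CliqueIn G (S ∪ T) (m₁ + m₂)
  CliqueIn-++ {S} {T} {m₁} S~T (f , f-inj , f-S , f-cl) (g , g-inj , g-T , g-cl) =
    f ++ g , h-inj , h-S∪T , λ s t s≢t → h-cl s t (s≢t ∘ h-inj)
    where
    h-inj = injective-++ f-inj g-inj λ s t → ~⇒≢ (S~T (f-S s) (g-T t))
    h-S∪T : ∀ s → (S ∪ T) ((f ++ g) s)
    h-S∪T s with splitAt m₁ s
    ... | inj₁ a = inj₁ (f-S a)
    ... | inj₂ b = inj₂ (g-T b)
    h-cl : ∀ s t → (f ++ g) s ≢ (f ++ g) t → (f ++ g) s ~ (f ++ g) t
    h-cl s t ne with splitAt m₁ s | splitAt m₁ t
    ... | inj₁ a | inj₁ b = f-cl a b (ne ∘ cong f)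
    ... | inj₁ a | inj₂ b = S~T (f-S a) (g-T b)
    ... | inj₂ a | inj₁ b = ~-sym (S~T (f-S b) (g-T a))
    ... | inj₂ a | inj₂ b = g-cl a b (ne ∘ cong g)

  P₃∪P₂-copy : ∀ {a₀ a₁ a₂ b₀ b₁} → a₀ ~ a₁ → a₁ ~ a₂ → a₀ ≁ a₂ → a₀ ≢ a₂ → b₀ ~ b₁
             → CommonNonNbr a₀ a₁ a₂ b₀ → CommonNonNbr a₀ a₁ a₂ b₁
             → InducedCopyIn G (λ _ → ⊤) P₃∪P₂
  P₃∪P₂-copy {a₀} {a₁} {a₂} {b₀} {b₁} a₀~a₁ a₁~a₂ a₀≁a₂ a₀≢a₂ b₀~b₁
             (a₀≁b₀ , a₁≁b₀ , a₂≁b₀) (a₀≁b₁ , a₁≁b₁ , a₂≁b₁) =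
    f , f-inj , (λ _ → tt) , pres
    where
    f : Fin 5 → Vertex G
    f = a₀ ∷ a₁ ∷ a₂ ∷ b₀ ∷ b₁ ∷ []
    f-inj : Injective _≡_ _≡_ f
    f-inj = injective-∷ (λ { 0F → ~⇒≢ a₀~a₁
                            ; 1F → a₀≢a₂
                            ; 2F → ~-≁⇒≢ a₀~a₁ (≁-sym a₁≁b₀)
                            ; 3F → ~-≁⇒≢ a₀~a₁ (≁-sym a₁≁b₁) })
          ( injective-∷ (λ { 0F → ~⇒≢ a₁~a₂
                            ; 1F → ~-≁⇒≢ (~-sym a₀~a₁) (≁-sym a₀≁b₀)
                            ; 2F → ~-≁⇒≢ (~-sym a₀~a₁) (≁-sym a₀≁b₁) })
          ( injective-∷ (λ { 0F → ~-≁⇒≢ (~-sym a₁~a₂) (≁-sym a₁≁b₀)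
                            ; 1F → ~-≁⇒≢ (~-sym a₁~a₂) (≁-sym a₁≁b₁) })
          ( injective-∷ (λ { 0F → ~⇒≢ b₀~b₁ })
          ( injective-∷ (λ ()) injective-[]))))
    pres : ∀ s t → adj G (f s) (f t) ≡ adj P₃∪P₂ s t
    pres 0F 0F = irref G a₀
    pres 0F 1F = a₀~a₁
    pres 0F 2F = a₀≁a₂
    pres 0F 3F = a₀≁b₀
    pres 0F 4F = a₀≁b₁
    pres 1F 0F = ~-sym a₀~a₁
    pres 1F 1F = irref G a₁
    pres 1F 2F = a₁~a₂
    pres 1F 3F = a₁≁b₀
    pres 1F 4F = a₁≁b₁
    pres 2F 0F = ≁-sym a₀≁a₂
    pres 2F 1F = ~-sym a₁~a₂
    pres 2F 2F = irref G a₂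
    pres 2F 3F = a₂≁b₀
    pres 2F 4F = a₂≁b₁
    pres 3F 0F = ≁-sym a₀≁b₀
    pres 3F 1F = ≁-sym a₁≁b₀
    pres 3F 2F = ≁-sym a₂≁b₀
    pres 3F 3F = irref G b₀
    pres 3F 4F = b₀~b₁
    pres 4F 0F = ≁-sym a₀≁b₁
    pres 4F 1F = ≁-sym a₁≁b₁
    pres 4F 2F = ≁-sym a₂≁b₁
    pres 4F 3F = ~-sym b₀~b₁
    pres 4F 4F = irref G b₁

  [K₁∪K₂]+K-copy : ∀ {p a b c} → b ~ c → a ≁ b → a ≁ c → CliqueIn G (CommonNbr a b c) p
                 → InducedCopyIn G (λ _ → ⊤) ([K₁∪K₂]+K p)
  -- The copy is listed on Fin (3 + p), with a, b, c first, and moved to Fin (p + 3) by mkAdj-cast.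
  [K₁∪K₂]+K-copy {p} {a} {b} {c} b~c a≁b a≁c (h , h-inj , h-nbr , h-cl) =
    f ∘ cast p+3≡3+p , cast-injective p+3≡3+p ∘ f-inj , (λ _ → tt) ,
    λ s t → trans (pres (cast p+3≡3+p s) (cast p+3≡3+p t)) (≡.sym (mkAdj-cast p+3≡3+p K-rule s t))
    where
    p+3≡3+p = +-comm p 3
    a~h = proj₁ ∘ h-nbr
    b~h = proj₁ ∘ proj₂ ∘ h-nbr
    c~h = proj₂ ∘ proj₂ ∘ h-nbr
    f : Fin (3 + p) → Vertex G
    f = a ∷ b ∷ c ∷ h
    f-inj : Injective _≡_ _≡_ f
    f-inj = injective-∷ (λ { 0F → ≁-~⇒≢ a≁c b~c ; 1F → ≁-~⇒≢ a≁b (~-sym b~c)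
                            ; (suc (suc t)) → ≁-~⇒≢ a≁b (~-sym (b~h t)) })
          ( injective-∷ (λ { 0F → ~⇒≢ b~c ; (suc t) → ~⇒≢ (b~h t) })
          ( injective-∷ (λ t → ~⇒≢ (c~h t)) h-inj))
    pres : ∀ s t → adj G (f s) (f t) ≡ mkAdj (λ m n → K-rule (toℕ m) (toℕ n)) s t
    pres 0F 0F = irref G a
    pres 0F 1F = a≁b
    pres 0F 2F = a≁c
    pres 0F (suc (suc (suc t))) = a~h t
    pres 1F 0F = ≁-sym a≁b
    pres 1F 1F = irref G b
    pres 1F 2F = b~c
    pres 1F (suc (suc (suc t))) = b~h t
    pres 2F 0F = ≁-sym a≁c
    pres 2F 1F = ~-sym b~c
    pres 2F 2F = irref G c
    pres 2F (suc (suc (suc t))) = c~h t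
    pres (suc (suc (suc s))) 0F = ~-sym (a~h s)
    pres (suc (suc (suc s))) 1F = ~-sym (b~h s)
    pres (suc (suc (suc s))) 2F = ~-sym (c~h s)
    pres (suc (suc (suc s))) (suc (suc (suc t))) with s ≟ t
    ... | yes refl = irref G (h s)
    ... | no s≢t   = h-cl s t s≢t

  subclique : ∀ {N} {u : Fin N → Vertex G} {P : Pred (Fin N) ℓ} {S : Pred (Vertex G) _}
            → IsClique G u → (P? : Decidable P) → m ≤ count P? → (∀ {t} → P t → S (u t))
            → CliqueIn G S m
  subclique {u = u} (u-inj , u-cl) P? m≤ P⇒S with pick P? m≤
  ... | f , f-inj , f-P = u ∘ f , f-inj ∘ u-inj , P⇒S ∘ f-P , λ s t s≢t → u-cl (f s) (f t) (s≢t ∘ f-inj)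

-- Arithmetic

distinct-below⇒2≤ : ∀ {a b N} → a <ℕ N → b <ℕ N → a ≢ b → 2 ≤ N
distinct-below⇒2≤ {zero}  {zero}  _               _               a≢b = contradiction refl a≢b
distinct-below⇒2≤ {suc a}         (s≤s (s≤s _)) _               _   = s≤s (s≤s z≤n)
distinct-below⇒2≤ {zero}  {suc b} _               (s≤s (s≤s _)) _   = s≤s (s≤s z≤n)

module _ {p m : ℕ} where

  large⇒≤∸2 : ∀ {J} → p + 3 ≤ J + m → 2 ≤ J → p ≤ (J ∸ 2) + m
  large⇒≤∸2 {suc (suc J)} large (s≤s (s≤s _)) =
    ≤-trans (m≤n⇒m≤1+n ≤-refl) (s≤s⁻¹ (s≤s⁻¹ (≤-trans (≤-reflexive (+-comm 3 p)) large)))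

  large⇒≤∸2∸1 : ∀ {J} → p + 3 ≤ J + m → 2 ≤ J → 1 ≤ m → p ≤ (J ∸ 2) + (m ∸ 1)
  large⇒≤∸2∸1 {suc (suc J)} large (s≤s (s≤s _)) (s≤s {n = m′} _) =
    s≤s⁻¹ (s≤s⁻¹ (s≤s⁻¹ (begin
      3 + p                  ≡⟨ +-comm 3 p ⟩
      p + 3                  ≤⟨ large ⟩
      2 + (J + suc m′)       ≡⟨ cong (2 +_) (+-suc J m′) ⟩
      3 + (J + m′)           ∎)))
    where open ≤-Reasoning

pigeonhole-arith : ∀ {p w L u cx cy cz r} → cx + L ≤ p → cy + L ≤ p → cz + L ≤ p
                 → p + p + p + 2 ≤ w + L + L → L + u ≡ w → u ≤ cx + (cy + cz) + r → 2 ≤ r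
pigeonhole-arith {p} {w} {L} {u} {cx} {cy} {cz} {r} x-bound y-bound z-bound bound L+u≡w u≤ =
  +-cancelˡ-≤ (p + p + p) 2 r (begin
    p + p + p + 2                               ≤⟨ bound ⟩
    w + L + L                                   ≡⟨ cong (λ w → w + L + L) (≡.sym L+u≡w) ⟩
    L + u + L + L                               ≤⟨ +-monoˡ-≤ L (+-monoˡ-≤ L (+-monoʳ-≤ L u≤)) ⟩
    L + (cx + (cy + cz) + r) + L + L            ≡⟨ regroup L cx cy cz r ⟩
    (cx + L) + (cy + L) + (cz + L) + r          ≤⟨ +-monoˡ-≤ r (+-mono-≤ (+-mono-≤ x-bound y-bound) z-bound) ⟩
    p + p + p + r                               ∎)
  where
  open ≤-Reasoning
  regroup : ∀ L cx cy cz r → L + (cx + (cy + cz) + r) + L + L ≡ (cx + L) + (cy + L) + (cz + L) + r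
  regroup = solve-∀

large-from-∸ : ∀ {p J} → J ≤ p → p + 3 ≤ J + ((p + 4) ∸ (J + 1))
large-from-∸ {p} {J} J≤p = +-cancelʳ-≤ 1 (p + 3) (J + X) (≤-reflexive (begin
  p + 3 + 1        ≡⟨ +-assoc p 3 1 ⟩
  p + 4            ≡⟨ ≡.sym (m+[n∸m]≡n (+-mono-≤ J≤p (s≤s {n = 3} z≤n))) ⟩
  J + 1 + X        ≡⟨ shuffle J X ⟩
  J + X + 1        ∎))
  where
  open ≡.≡-Reasoning
  X = (p + 4) ∸ (J + 1)
  shuffle : ∀ J X → J + 1 + X ≡ J + X + 1
  shuffle = solve-∀

threshold-≤ : ∀ {p h J} → 2 ⊔ ((p + 1) ∸ h) ≤ J + 1 → p ∸ h ≤ J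
threshold-≤ {p} {h} {J} j₀≤ = m≤n+o⇒m∸n≤o p h (+-cancelʳ-≤ 1 p (h + J) (begin
  p + 1                ≤⟨ m≤n+m∸n (p + 1) h ⟩
  h + ((p + 1) ∸ h)    ≤⟨ +-monoʳ-≤ h (≤-trans (m≤n⊔m 2 _) j₀≤) ⟩
  h + (J + 1)          ≡⟨ ≡.sym (+-assoc h J 1) ⟩
  h + J + 1            ∎))
  where open ≤-Reasoning

threshold-bound : ∀ p k → p + p + p + 2 ≤ (p + 2 + k) + (p ∸ k / 2) + (p ∸ k / 2)
threshold-bound p k = begin
  p + p + p + 2                   ≡⟨ shuffle₁ p ⟩
  (p + 2) + p + p                 ≤⟨ +-mono-≤ (+-monoʳ-≤ (p + 2) (m≤n+m∸n p h)) (m≤n+m∸n p h) ⟩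
  (p + 2) + (h + L) + (h + L)     ≡⟨ shuffle₂ p h L ⟩
  (p + 2) + (h + h) + L + L       ≤⟨ +-monoˡ-≤ L (+-monoˡ-≤ L (+-monoʳ-≤ (p + 2) h+h≤k)) ⟩
  (p + 2 + k) + L + L             ∎
  where
  open ≤-Reasoning
  h = k / 2
  L = p ∸ h
  h+h≤k : h + h ≤ k
  h+h≤k = ≤-trans (≤-reflexive (double h)) (m/n*n≤m k 2)
    where
    double : ∀ h → h + h ≡ h * 2
    double = solve-∀
  shuffle₁ : ∀ p → p + p + p + 2 ≡ (p + 2) + p + p
  shuffle₁ = solve-∀
  shuffle₂ : ∀ p h L → (p + 2) + (h + L) + (h + L) ≡ (p + 2) + (h + h) + L + L
  shuffle₂ = solve-∀

-- The sets C_{i,j}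

module Partition (G : Graph) (p : ℕ) (P₃∪P₂-free : Free G P₃∪P₂) (K-free : Free G ([K₁∪K₂]+K p))
                 {w : ℕ} (v : Fin w → Vertex G) (v-clique : IsClique G v) where

  open Adjacency G

  private variable
    i j k s t : Fin w
    u : Vertex G
    L : ℕ

  v~v : s ≢ t → v s ~ v t
  v~v = proj₂ v-clique _ _

  nbr-index-≢ : x ≁ v s → x ~ v t → s ≢ t
  nbr-index-≢ x≁vs x~vt = ≁-~⇒≢ (≁-sym x≁vs) (~-sym x~vt) ∘ cong v

  NbrA : Vertex G → Pred (Fin w) _
  NbrA x t = x ~ v t

  nbrA? : ∀ x → Decidable (NbrA x)
  nbrA? x t = x ~? v t

  below? : ∀ L → Decidable (λ (t : Fin w) → toℕ t <ℕ L)
  below? L t = toℕ t <ℕ? L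

  no-common-clique : ∀ {a b c m} → b ~ c → a ≁ b → a ≁ c → p ≤ m → ¬ CliqueIn G (CommonNbr a b c) m
  no-common-clique {a} {b} {c} b~c a≁b a≁c p≤m K =
    K-free ([K₁∪K₂]+K-copy b~c a≁b a≁c (CliqueIn-shrink {S = CommonNbr a b c} p≤m K))

  C⇒∉A : C G v i j x → x ≢ v t
  C⇒∉A (x∉A , _) = x∉A _

  C⇒≁ᵢ : C G v i j x → x ≁ v i
  C⇒≁ᵢ (_ , x≁vi , _) = x≁vi

  C⇒≁ⱼ : C G v i j x → x ≁ v j
  C⇒≁ⱼ (_ , _ , x≁vj , _) = x≁vj

  -- Every earlier pair (t, i) or (i, t) must meet the neighbourhood of x, and v i does not.
  C⇒~ : C G v i j x → t < j → t ≢ i → x ~ v t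
  C⇒~ {i = i} {t = t} (_ , x≁vi , _ , earlier) t<j t≢i with Fin.<-cmp t i
  ... | tri≈ _ t≡i _ = contradiction t≡i t≢i
  ... | tri< t<i _ _ = [ id , (λ x~vi → contradiction (trans (≡.sym x≁vi) x~vi) λ ()) ]′
                         (earlier t i t<i (inj₁ t<i))
  ... | tri> _ _ i<t = [ (λ x~vi → contradiction (trans (≡.sym x≁vi) x~vi) λ ()) , id ]′
                         (earlier i t i<t (inj₂ (refl , t<j)))

  -- Otherwise x, v i, v j and p common neighbours in A would form a (K₁ ∪ K₂) + K_p.
  few-nbrs-in-A : i ≢ j → x ≁ v i → x ≁ v j → count (nbrA? x) <ℕ p
  few-nbrs-in-A {i = i} {j = j} {x = x} i≢j x≁vi x≁vj = ≰⇒> λ p≤count →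
    K-free ([K₁∪K₂]+K-copy (v~v i≢j) x≁vi x≁vj
      (subclique {S = CommonNbr x (v i) (v j)} v-clique (nbrA? x) p≤count λ x~vt →
        x~vt , v~v (nbr-index-≢ x≁vi x~vt) , v~v (nbr-index-≢ x≁vj x~vt)))

  C-nbrs-below : C G v i j x → L ≤ toℕ j → L ≤ suc (count (nbrA? x ∩? below? L))
  C-nbrs-below {i = i} {j = j} {x = x} {L = L} x∈C L≤J = begin
    L                                     ≡⟨ ≡.sym (count-< L (≤-trans L≤J (<⇒≤ (Fin.toℕ<n j)))) ⟩
    count (below? L)                      ≤⟨ count-remove (below? L) i ⟩
    suc (count (below? L ∩? ∁? (_≟ i)))   ≤⟨ s≤s (count-mono (below? L ∩? ∁? (_≟ i)) (nbrA? x ∩? below? L)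
                                                λ (t<L , t≢i) → C⇒~ x∈C (<-≤-trans t<L L≤J) t≢i , t<L) ⟩
    suc (count (nbrA? x ∩? below? L))     ∎
    where open ≤-Reasoning

  C-empty : p <ℕ toℕ j → k < j → ¬ C G v k j x
  C-empty {j = j} {x = x} p<J k<j x∈C = <⇒≱ p<J (begin
    toℕ j                                    ≤⟨ C-nbrs-below x∈C ≤-refl ⟩
    suc (count (nbrA? x ∩? below? (toℕ j)))  ≤⟨ s≤s (count-mono (nbrA? x ∩? below? (toℕ j)) (nbrA? x) proj₁) ⟩
    suc (count (nbrA? x))                    ≤⟨ few-nbrs-in-A (Fin.<⇒≢ k<j) (C⇒≁ᵢ x∈C) (C⇒≁ⱼ x∈C) ⟩
    p                                        ∎)
    where open ≤-Reasoning

  C-nbrs-above : C G v i j x → i < j → L ≤ toℕ j → count (nbrA? x ∩? ∁? (below? L)) + L ≤ p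
  C-nbrs-above {x = x} {L = L} x∈C i<j L≤J = begin
    above + L                   ≤⟨ +-monoʳ-≤ above (C-nbrs-below x∈C L≤J) ⟩
    above + suc under           ≡⟨ +-suc above under ⟩
    suc (above + under)         ≡⟨ cong suc (+-comm above under) ⟩
    suc (under + above)         ≡⟨ cong suc (≡.sym (count-split (nbrA? x) (below? L))) ⟩
    suc (count (nbrA? x))       ≤⟨ few-nbrs-in-A (Fin.<⇒≢ i<j) (C⇒≁ᵢ x∈C) (C⇒≁ⱼ x∈C) ⟩
    p                           ∎
    where
    open ≤-Reasoning
    above = count (nbrA? x ∩? ∁? (below? L))
    under = count (nbrA? x ∩? below? L)

  module SharedIndex {i j k : Fin w} (i<j : i < j) (k<j : k < j) (k≢i : k ≢ i)
                     {m : ℕ} (Q : CliqueIn G (C G v i j) m) (large : p + 3 ≤ toℕ j + m) where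

    q : Fin m → Vertex G
    q = proj₁ Q

    q-clique : IsClique G q
    q-clique = proj₁ (proj₂ Q) , proj₂ (proj₂ (proj₂ Q))

    q∈C : ∀ r → C G v i j (q r)
    q∈C = proj₁ (proj₂ (proj₂ Q))

    two≤J : 2 ≤ toℕ j
    two≤J = distinct-below⇒2≤ k<j i<j (k≢i ∘ Fin.toℕ-injective)

    Hub : Pred (Vertex G) _
    Hub x = v k ~ x × (∀ {u} → C G v i j u → u ~ x) × (∀ {u} → C G v k j u → u ~ x)

    hub~C : Hub x → C G v i j y → x ~ y
    hub~C (_ , Cij~x , _) y∈C = ~-sym (Cij~x y∈C)

    hub-clique : CliqueIn G Hub (toℕ j ∸ 2)
    hub-clique = subclique {S = Hub} v-clique lower? (m≤n+o⇒m∸n≤o _ 2 J≤2+count)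
      λ ((t<j , t≢i) , t≢k) →
        v~v (t≢k ∘ ≡.sym) , (λ u∈C → C⇒~ u∈C t<j t≢i) , (λ u∈C → C⇒~ u∈C t<j t≢k)
      where
      below-but-i? = below? (toℕ j) ∩? ∁? (_≟ i)
      lower? = below-but-i? ∩? ∁? (_≟ k)
      J≤2+count : toℕ j ≤ 2 + count lower?
      J≤2+count = begin
        toℕ j                            ≡⟨ ≡.sym (count-< (toℕ j) (<⇒≤ (Fin.toℕ<n j))) ⟩
        count (below? (toℕ j))           ≤⟨ count-remove (below? (toℕ j)) i ⟩
        suc (count below-but-i?)         ≤⟨ s≤s (count-remove below-but-i? k) ⟩
        2 + count lower?                 ∎
        where open ≤-Reasoning

    hub-++ : ∀ {T : Pred (Vertex G) _} {m′} → T ⊆ C G v i j → CliqueIn G T m′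
           → CliqueIn G (Hub ∪ T) (toℕ j ∸ 2 + m′)
    hub-++ {T} T⊆C = CliqueIn-++ {S = Hub} {T = T} (λ hub y∈T → hub~C hub (T⊆C y∈T)) hub-clique

    C-complete-to-Q : C G v k j u → ∀ r → u ~ q r
    C-complete-to-Q {u} u∈C r with u ~? q r
    ... | yes u~qr = u~qr
    ... | no ¬u~qr with Fin.any? (λ r′ → ¬? (r′ ≟ r) ×-dec ¬? (u ~? q r′))
    ...   | yes (r′ , r′≢r , ¬u~qr′) =
      contradiction (P₃∪P₂-copy (C⇒~ u∈C i<j (k≢i ∘ ≡.sym)) (v~v (Fin.<⇒≢ i<j)) (C⇒≁ⱼ u∈C)
                                (C⇒∉A u∈C) (proj₂ q-clique r r′ (r′≢r ∘ ≡.sym)) (far ¬u~qr) (far ¬u~qr′))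
                    P₃∪P₂-free
      where
      far : ∀ {r} → ¬ u ~ q r → CommonNonNbr u (v i) (v j) (q r)
      far {r} ¬u~qr = ¬~⇒≁ ¬u~qr , ≁-sym (C⇒≁ᵢ (q∈C r)) , ≁-sym (C⇒≁ⱼ (q∈C r))
    ...   | no none =
      contradiction (CliqueIn-mono {S = Hub ∪ T} common (hub-++ {T = T} proj₁ rest))
                    (no-common-clique (C⇒~ (q∈C r) k<j k≢i) (¬~⇒≁ ¬u~qr) (C⇒≁ᵢ u∈C)
                                      (large⇒≤∸2∸1 large two≤J (<-≤-trans (s≤s z≤n) (Fin.toℕ<n r))))
      where
      T : Pred (Vertex G) _
      T x = C G v i j x × u ~ x × q r ~ x
      u~rest : ∀ {r′} → r′ ≢ r → u ~ q r′
      u~rest {r′} r′≢r = decidable-stable (u ~? q r′) λ ¬u~qr′ → none (r′ , r′≢r , ¬u~qr′)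
      rest : CliqueIn G T (m ∸ 1)
      rest = subclique {S = T} q-clique (∁? (_≟ r)) m∸1≤count λ {r′} r′≢r →
        q∈C r′ , u~rest r′≢r , proj₂ q-clique r r′ (r′≢r ∘ ≡.sym)
        where
        m∸1≤count : m ∸ 1 ≤ count (∁? (_≟ r))
        m∸1≤count = m≤n+o⇒m∸n≤o m 1 (begin
          m                                         ≡⟨ ≡.sym (count-∁ (_≟ r)) ⟩
          count (_≟ r) + count (∁? (_≟ r))          ≤⟨ +-monoˡ-≤ _ (count-≤1 (_≟ r) λ { refl refl → refl }) ⟩
          1 + count (∁? (_≟ r))                     ∎)
          where open ≤-Reasoning
      common : Hub ∪ T ⊆ CommonNbr u (q r) (v k)
      common (inj₁ (vk~x , Cij~x , Ckj~x)) = Ckj~x u∈C , Cij~x (q∈C r) , vk~x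
      common (inj₂ (x∈C , u~x , qr~x))     = u~x , qr~x , ~-sym (C⇒~ x∈C k<j k≢i)

    no-edge : ¬ CliqueIn G (C G v k j) 2
    no-edge (yz , _ , yz∈C , yz-cl) =
      no-common-clique (yz-cl 0F 1F λ ()) (≁-sym (C⇒≁ᵢ y∈C)) (≁-sym (C⇒≁ᵢ z∈C))
                       (large⇒≤∸2 large two≤J)
        (CliqueIn-mono {S = Hub ∪ T} common (hub-++ {T = T} proj₁ Q-complete))
      where
      y∈C = yz∈C 0F
      z∈C = yz∈C 1F
      T : Pred (Vertex G) _
      T x = C G v i j x × (∀ {u} → C G v k j u → u ~ x)
      Q-complete : CliqueIn G T m
      Q-complete = q , proj₁ q-clique , (λ r → q∈C r , λ u∈C → C-complete-to-Q u∈C r) , proj₂ q-clique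
      common : Hub ∪ T ⊆ CommonNbr (v k) (yz 0F) (yz 1F)
      common (inj₁ (vk~x , _ , Ckj~x)) = vk~x , Ckj~x y∈C , Ckj~x z∈C
      common (inj₂ (x∈C , Ckj~x))      = ~-sym (C⇒~ x∈C k<j k≢i) , Ckj~x y∈C , Ckj~x z∈C

  C-no-edge : i < j → CliqueIn G (C G v i j) ((p + 4) ∸ (toℕ j + 1)) → k < j → k ≢ i
            → ¬ CliqueIn G (C G v k j) 2
  C-no-edge {j = j} i<j Q k<j k≢i with p <ℕ? toℕ j
  ... | yes p<J = λ (_ , _ , y∈C , _) → C-empty p<J k<j (y∈C 0F)
  ... | no p≮J  = SharedIndex.no-edge i<j k<j k≢i Q (large-from-∸ (≮⇒≥ p≮J))

  C≥ : ℕ → Pred (Vertex G) _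
  C≥ L x = Σ (Fin w) λ i → Σ (Fin w) λ j → i < j × L ≤ toℕ j × C G v i j x

  C≥⇒≤w : C≥ L x → L ≤ w
  C≥⇒≤w (_ , j , _ , L≤J , _) = ≤-trans L≤J (<⇒≤ (Fin.toℕ<n j))

  commonNonNbrA? : ∀ x y z → Decidable (λ t → CommonNonNbr x y z (v t))
  commonNonNbrA? x y z t = x ≁? v t ×-dec y ≁? v t ×-dec z ≁? v t

  common-non-nbrs : p + p + p + 2 ≤ w + L + L → C≥ L x → C≥ L y → C≥ L z
                  → 2 ≤ count (commonNonNbrA? x y z)
  common-non-nbrs {L} {x} {y} {z} bound x∈C≥ y∈C≥ z∈C≥ =
    ≤-trans (pigeonhole-arith (nbrs-above x∈C≥) (nbrs-above y∈C≥) (nbrs-above z∈C≥) bound L+U≡w U≤)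
            (count-mono missed? (commonNonNbrA? x y z) λ (_ , ¬N) →
               ¬~⇒≁ (¬N ∘ inj₁) , ¬~⇒≁ (¬N ∘ inj₂ ∘ inj₁) , ¬~⇒≁ (¬N ∘ inj₂ ∘ inj₂))
    where
    U? = ∁? (below? L)
    N? = nbrA? x ∪? nbrA? y ∪? nbrA? z
    missed? = U? ∩? ∁? N?
    nbrs-above : C≥ L u → count (nbrA? u ∩? U?) + L ≤ p
    nbrs-above (_ , _ , i<j , L≤J , u∈C) = C-nbrs-above u∈C i<j L≤J
    L+U≡w : L + count U? ≡ w
    L+U≡w = trans (cong (_+ count U?) (≡.sym (count-< L (C≥⇒≤w x∈C≥)))) (count-∁ (below? L))
    U≤ : count U? ≤ count (nbrA? x ∩? U?) + (count (nbrA? y ∩? U?) + count (nbrA? z ∩? U?)) + count missed?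
    U≤ = begin
      count U?                                                  ≡⟨ count-split U? N? ⟩
      count (U? ∩? N?) + count missed?                          ≤⟨ +-monoˡ-≤ _ N-bound ⟩
      count (nbrA? x ∩? U?) + (count (nbrA? y ∩? U?) + count (nbrA? z ∩? U?)) + count missed? ∎
      where
      open ≤-Reasoning
      U = ∁ (λ t → toℕ t <ℕ L)
      distrib : U ∩ (NbrA x ∪ NbrA y ∪ NbrA z) ⊆ (NbrA x ∩ U) ∪ (NbrA y ∩ U) ∪ (NbrA z ∩ U)
      distrib (t∈U , inj₁ x~)        = inj₁ (x~ , t∈U)
      distrib (t∈U , inj₂ (inj₁ y~)) = inj₂ (inj₁ (y~ , t∈U))
      distrib (t∈U , inj₂ (inj₂ z~)) = inj₂ (inj₂ (z~ , t∈U))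
      N-bound = begin
        count (U? ∩? N?)
          ≤⟨ count-mono (U? ∩? N?) ((nbrA? x ∩? U?) ∪? (nbrA? y ∩? U?) ∪? (nbrA? z ∩? U?)) distrib ⟩
        count ((nbrA? x ∩? U?) ∪? (nbrA? y ∩? U?) ∪? (nbrA? z ∩? U?))
          ≤⟨ count-∪ (nbrA? x ∩? U?) ((nbrA? y ∩? U?) ∪? (nbrA? z ∩? U?)) ⟩
        count (nbrA? x ∩? U?) + count ((nbrA? y ∩? U?) ∪? (nbrA? z ∩? U?))
          ≤⟨ +-monoʳ-≤ _ (count-∪ (nbrA? y ∩? U?) (nbrA? z ∩? U?)) ⟩
        count (nbrA? x ∩? U?) + (count (nbrA? y ∩? U?) + count (nbrA? z ∩? U?)) ∎

  C≥-P₃-free : p + p + p + 2 ≤ w + L + L → InducedFreeOn G (C≥ L) P₃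
  C≥-P₃-free bound (f , f-inj , f-C≥ , f-pres)
    with pick (commonNonNbrA? (f 0F) (f 1F) (f 2F)) (common-non-nbrs bound (f-C≥ 0F) (f-C≥ 1F) (f-C≥ 2F))
  ... | g , g-inj , g-far =
    P₃∪P₂-free (P₃∪P₂-copy (f-pres 0F 1F) (f-pres 1F 2F) (f-pres 0F 2F) (λ e → contradiction (f-inj e) λ ())
                           (v~v λ e → contradiction (g-inj e) λ ()) (g-far 0F) (g-far 1F))

proposition3p2 : (p : ℕ) → 1 ≤ p → (G : Graph) → Free G P₃∪P₂ → Free G ([K₁∪K₂]+K p)
    → (w : ℕ) → (v : Fin w → Vertex G) → IsMaxClique G v → p + 2 ≤ w
    → ((i j : Fin w) → i < j → CliqueIn G (C G v i j) ((p + 4) ∸ (toℕ j + 1))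
        → (k : Fin w) → k < j → k ≢ i → ¬ CliqueIn G (C G v k j) 2)
      × ((k : ℕ) → w ≡ p + 2 + k
        → InducedFreeOn G
            (λ x → Σ (Fin w) λ i → Σ (Fin w) λ j → i < j
              × (2 ⊔ ((p + 1) ∸ (k / 2))) ≤ toℕ j + 1 × toℕ j + 1 ≤ p + 1
              × C G v i j x)
            P₃)
proposition3p2 p _ G P₃∪P₂-free K-free w v (v-clique , _) _ =
  (λ i j i<j Q k k<j k≢i → C-no-edge i<j Q k<j k≢i) ,
  λ { k refl (f , f-inj , f-S , f-pres) →
        C≥-P₃-free (threshold-bound p k)
          (f , f-inj , (λ (i , j , i<j , j₀≤ , _ , x∈C) → i , j , i<j , threshold-≤ {p} {k / 2} j₀≤ , x∈C) ∘ f-S ,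
           f-pres) }
  where open Partition G p P₃∪P₂-free K-free v v-clique
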